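{- (Linearity) Assume $\Gamma\vdash t_1t_2:\tau$ for some context $\Gamma$ and type $\tau$. Then either $t_2=\{t_2'\}$ for some closed term $t_2'$, or there are types $\tau',\tau''$ and disjoint contexts $\Gamma_1,\Gamma_2$ such that $\Gamma_1\vdash t_1:\tau'$ and $\Gamma_2\vdash t_2:\tau''$.
   Context: Linear types are generated by $\rho,\tau ::= \Diamond \mid \mathbf{B} \mid \tau\multimap\rho \mid \tau\otimes\rho \mid \tau\times\rho \mid \mathbf{L}(\tau)$. There are infinitely many variables of each type; $x^\tau$ denotes a variable $x$ of type $\tau$. Raw terms are $r,s,t ::= x^\tau \mid c \mid \lambda x^\tau.t \mid \langle t,s\rangle \mid t s \mid \{t\}$, where the constants $c$ are $\mathsf{tt},\mathsf{ff}$ of type $\mathbf B$, $\mathsf{nil}_\tau$ of type $\mathbf L(\tau)$, $\mathsf{cons}_\tau$ of type $\Diamond\multimap\tau\multimap\mathbf L(\tau)\multimap\mathbf L(\tau)$, and $\otimes_{\tau,\rho}$ of type $\tau\multimap\rho\multimap\tau\otimes\rho$. Application associates to the left, $\lambda x,y.t$ abbreviates $\lambda x.\lambda y.t$, $\alpha$-equivalent terms are identified, and free variables are defined as usual. A context is a finite set of variables; $\Gamma_1,\Gamma_2$ denotes $\Gamma_1\cup\Gamma_2$ where these are disjoint. The typing relation $\Gamma\vdash t:\tau$ is inductively defined by: (Var) $\Gamma,x^\tau\vdash x:\tau$; (Const) $\Gamma\vdash c:\tau$ if $c$ has type $\tau$; ($\multimap^+$) from $\Gamma\cup\{x^\tau\}\vdash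 t:\rho$ infer $\Gamma\vdash\lambda x^\tau.t:\tau\multimap\rho$; ($\multimap^-$) from $\Gamma_1\vdash t:\tau\multimap\rho$ and $\Gamma_2\vdash s:\tau$ infer $\Gamma_1,\Gamma_2\vdash ts:\rho$; ($\times^+$) from $\Gamma\vdash t:\tau$ and $\Gamma\vdash s:\rho$ infer $\Gamma\vdash\langle t,s\rangle:\tau\times\rho$; ($\times^-$) from $\Gamma\vdash t:\tau\times\rho$ infer $\Gamma\vdash t\,\mathsf{tt}:\tau$ and $\Gamma\vdash t\,\mathsf{ff}:\rho$; ($\mathbf B^-$) from $\Gamma_1\vdash t:\mathbf B$, $\Gamma_2\vdash s:\tau$, $\Gamma_2\vdash r:\tau$ infer $\Gamma_1,\Gamma_2\vdash t\langle s,r\rangle:\tau$; ($\otimes^-$) from $\Gamma_1\vdash t:\tau\otimes\rho$ and $\Gamma_2,x^\tau,y^\rho\vdash s:\sigma$ infer $\Gamma_1,\Gamma_2\vdash t(\lambda x^\tau,y^\rho.s):\sigma$; ($\mathbf L^-$) from $\Gamma\vdash t:\mathbf L(\tau)$ and $\emptyset\vdash s:\Diamond\multimap\tau\multimap\rho\multimap\rho$ infer $\Gamma\vdash t\{s\}:\rho\multimap\rho$. -}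

module Defs where

open import Data.Nat using (ℕ)
open import Data.List using (List; []; _∷_; _++_)
open import Data.List.Membership.Propositional using (_∈_; _∉_)
open import Data.Product using (_×_; _,_)
open import Function.Bundles using (_⇔_)
open import Relation.Binary.PropositionalEquality using (_≡_; _≢_)
open import Data.Empty using (⊥)
open import Relation.Nullary using (¬_)

infixr 30 _⊸_
infixr 31 _⊗_ _&_

-- Linear types: ◇ | B | τ ⊸ ρ | τ ⊗ ρ | τ × ρ (written _&_) | L τ
data Ty : Set where
  ◇ 𝐁 : Ty
  _⊸_ _⊗_ _&_ : Ty → Ty → Ty
  𝐋 : Ty → Ty

record Var : Set where
  constructor _^_
  field
    name : ℕ
    ty   : Ty
open Var public

data Const : Set where
  tt ff : Const
  nil cons : Ty → Const
  tensor : Ty → Ty → Const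

constTy : Const → Ty
constTy tt = 𝐁
constTy ff = 𝐁
constTy (nil τ) = 𝐋 τ
constTy (cons τ) = ◇ ⊸ τ ⊸ 𝐋 τ ⊸ 𝐋 τ
constTy (tensor τ ρ) = τ ⊸ ρ ⊸ τ ⊗ ρ

data Term : Set where
  var   : Var → Term
  con   : Const → Term
  lam   : Var → Term → Term
  pair  : Term → Term → Term
  app   : Term → Term → Term
  brace : Term → Term

data Free (v : Var) : Term → Set where
  var   : Free v (var v)
  lam   : ∀ {x t} → v ≢ x → Free v t → Free v (lam x t)
  pairˡ : ∀ {t s} → Free v t → Free v (pair t s)
  pairʳ : ∀ {t s} → Free v s → Free v (pair t s)
  appˡ  : ∀ {t s} → Free v t → Free v (app t s)
  appʳ  : ∀ {t s} → Free v s → Free v (app t s)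
  brace : ∀ {t} → Free v t → Free v (brace t)

Closed : Term → Set
Closed t = ∀ v → ¬ Free v t

-- Contexts: finite sets of variables, represented by lists read as sets.
Ctx : Set
Ctx = List Var

_≈_ : Ctx → Ctx → Set
Γ ≈ Δ = ∀ v → (v ∈ Γ) ⇔ (v ∈ Δ)

Disjoint : Ctx → Ctx → Set
Disjoint Γ Δ = ∀ {v} → v ∈ Γ → v ∈ Δ → ⊥

_≡_⊎_ : Ctx → Ctx → Ctx → Set
Γ ≡ Γ₁ ⊎ Γ₂ = Disjoint Γ₁ Γ₂ × (Γ ≈ (Γ₁ ++ Γ₂))

infix 4 _⊢_∶_
data _⊢_∶_ : Ctx → Term → Ty → Set where
  ax-var : ∀ {Γ x} → x ∈ Γ → Γ ⊢ var x ∶ ty x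
  ax-con : ∀ {Γ c} → Γ ⊢ con c ∶ constTy c
  ⊸⁺    : ∀ {Γ x t ρ} → (x ∷ Γ) ⊢ t ∶ ρ → Γ ⊢ lam x t ∶ ty x ⊸ ρ
  ⊸⁻    : ∀ {Γ Γ₁ Γ₂ t s τ ρ} → Γ ≡ Γ₁ ⊎ Γ₂ →
          Γ₁ ⊢ t ∶ τ ⊸ ρ → Γ₂ ⊢ s ∶ τ → Γ ⊢ app t s ∶ ρ
  &⁺    : ∀ {Γ t s τ ρ} → Γ ⊢ t ∶ τ → Γ ⊢ s ∶ ρ → Γ ⊢ pair t s ∶ τ & ρ
  &⁻₁   : ∀ {Γ t τ ρ} → Γ ⊢ t ∶ τ & ρ → Γ ⊢ app t (con tt) ∶ τ
  &⁻₂   : ∀ {Γ t τ ρ} → Γ ⊢ t ∶ τ & ρ → Γ ⊢ app t (con ff) ∶ ρ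
  𝐁⁻    : ∀ {Γ Γ₁ Γ₂ t s r τ} → Γ ≡ Γ₁ ⊎ Γ₂ →
          Γ₁ ⊢ t ∶ 𝐁 → Γ₂ ⊢ s ∶ τ → Γ₂ ⊢ r ∶ τ → Γ ⊢ app t (pair s r) ∶ τ
  ⊗⁻    : ∀ {Γ Γ₁ Γ₂ t s x y σ} → Γ ≡ Γ₁ ⊎ Γ₂ →
          x ∉ Γ₂ → y ∉ Γ₂ → x ≢ y →
          Γ₁ ⊢ t ∶ ty x ⊗ ty y → (x ∷ y ∷ Γ₂) ⊢ s ∶ σ →
          Γ ⊢ app t (lam x (lam y s)) ∶ σ
  𝐋⁻    : ∀ {Γ t s τ ρ} → Γ ⊢ t ∶ 𝐋 τ → [] ⊢ s ∶ ◇ ⊸ τ ⊸ ρ ⊸ ρ →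
          Γ ⊢ app t (brace s) ∶ ρ ⊸ ρ

{-# OPTIONS --safe #-}
module Submission where

-- Every rule concluding an
-- application either splits the context between function and argument
-- (⊸⁻, 𝐁⁻, ⊗⁻; for ⊗⁻ the body is re-abstracted after exchanging the two
-- bound variables), or types a constant argument in the empty context
-- (&⁻), or is 𝐋⁻, whose braced argument is typed in the empty context and
-- is therefore closed.

open import Defs
open import Data.Product using (Σ; _×_; _,_)
open import Data.Sum using (_⊎_; inj₁; inj₂)
open import Relation.Binary.PropositionalEquality using (_≡_; refl)
open import Data.List using ([]; _∷_)
open import Data.List.Relation.Unary.Any using (tail)
open import Data.List.Membership.Propositional using (_∈_)
open import Data.List.Membership.Propositional.Properties using (∈-++⁺ˡ; ∈-++⁺ʳ)
open import Data.List.Relation.Binary.Permutation.Propositional using (_↭_; ↭-refl; ↭-sym; ↭-swap)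
open import Data.List.Relation.Binary.Permutation.Propositional.Properties using (∈-resp-↭)
open import Data.List.Relation.Binary.BagAndSetEquality using (∷-cong; set)
open import Function.Bundles using (Equivalence; mk⇔)
import Function.Properties.Equivalence as ⇔

≈-sym : ∀ {Γ Δ} → Γ ≈ Δ → Δ ≈ Γ
≈-sym Γ≈Δ v = ⇔.sym (Γ≈Δ v)

≈-trans : ∀ {Γ Δ Θ} → Γ ≈ Δ → Δ ≈ Θ → Γ ≈ Θ
≈-trans Γ≈Δ Δ≈Θ v = ⇔.trans (Γ≈Δ v) (Δ≈Θ v)

∷-cong-≈ : ∀ x {Γ Δ} → Γ ≈ Δ → (x ∷ Γ) ≈ (x ∷ Δ)
∷-cong-≈ x Γ≈Δ v = ∷-cong {k = set} refl (λ {w} → Γ≈Δ w)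

↭⇒≈ : ∀ {Γ Δ} → Γ ↭ Δ → Γ ≈ Δ
↭⇒≈ Γ↭Δ v = mk⇔ (∈-resp-↭ Γ↭Δ) (∈-resp-↭ (↭-sym Γ↭Δ))

⊎-resp-≈ : ∀ {Γ Δ Γ₁ Γ₂} → Γ ≈ Δ → _≡_⊎_ Γ Γ₁ Γ₂ → _≡_⊎_ Δ Γ₁ Γ₂
⊎-resp-≈ Γ≈Δ (disjoint , Γ≈Γ₁Γ₂) = disjoint , ≈-trans (≈-sym Γ≈Δ) Γ≈Γ₁Γ₂

∈-⊎⁺ˡ : ∀ {Γ Γ₁ Γ₂ v} → _≡_⊎_ Γ Γ₁ Γ₂ → v ∈ Γ₁ → v ∈ Γ
∈-⊎⁺ˡ (_ , Γ≈Γ₁Γ₂) v∈Γ₁ = Equivalence.from (Γ≈Γ₁Γ₂ _) (∈-++⁺ˡ v∈Γ₁)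

∈-⊎⁺ʳ : ∀ {Γ Γ₁ Γ₂ v} → _≡_⊎_ Γ Γ₁ Γ₂ → v ∈ Γ₂ → v ∈ Γ
∈-⊎⁺ʳ {Γ₁ = Γ₁} (_ , Γ≈Γ₁Γ₂) v∈Γ₂ = Equivalence.from (Γ≈Γ₁Γ₂ _) (∈-++⁺ʳ Γ₁ v∈Γ₂)

⊢-resp-≈ : ∀ {Γ Δ t τ} → Γ ≈ Δ → Γ ⊢ t ∶ τ → Δ ⊢ t ∶ τ
⊢-resp-≈ Γ≈Δ (ax-var x∈Γ)       = ax-var (Equivalence.to (Γ≈Δ _) x∈Γ)
⊢-resp-≈ Γ≈Δ ax-con             = ax-con
⊢-resp-≈ Γ≈Δ (⊸⁺ ⊢t)            = ⊸⁺ (⊢-resp-≈ (∷-cong-≈ _ Γ≈Δ) ⊢t)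
⊢-resp-≈ Γ≈Δ (⊸⁻ split ⊢t ⊢s)     = ⊸⁻ (⊎-resp-≈ Γ≈Δ split) ⊢t ⊢s
⊢-resp-≈ Γ≈Δ (&⁺ ⊢t ⊢s)         = &⁺ (⊢-resp-≈ Γ≈Δ ⊢t) (⊢-resp-≈ Γ≈Δ ⊢s)
⊢-resp-≈ Γ≈Δ (&⁻₁ ⊢t)           = &⁻₁ (⊢-resp-≈ Γ≈Δ ⊢t)
⊢-resp-≈ Γ≈Δ (&⁻₂ ⊢t)           = &⁻₂ (⊢-resp-≈ Γ≈Δ ⊢t)
⊢-resp-≈ Γ≈Δ (𝐁⁻ split ⊢t ⊢s ⊢r) = 𝐁⁻ (⊎-resp-≈ Γ≈Δ split) ⊢t ⊢s ⊢r
⊢-resp-≈ Γ≈Δ (⊗⁻ split x∉ y∉ x≢y ⊢t ⊢s) =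
  ⊗⁻ (⊎-resp-≈ Γ≈Δ split) x∉ y∉ x≢y ⊢t ⊢s
⊢-resp-≈ Γ≈Δ (𝐋⁻ ⊢t ⊢s)         = 𝐋⁻ (⊢-resp-≈ Γ≈Δ ⊢t) ⊢s

⊢-exchange : ∀ {x y Γ t τ} → (x ∷ y ∷ Γ) ⊢ t ∶ τ → (y ∷ x ∷ Γ) ⊢ t ∶ τ
⊢-exchange {x} {y} = ⊢-resp-≈ (↭⇒≈ (↭-swap x y ↭-refl))

Free⇒∈ : ∀ {Γ t τ v} → Γ ⊢ t ∶ τ → Free v t → v ∈ Γ
Free⇒∈ (ax-var v∈Γ)             var                        = v∈Γ
Free⇒∈ (⊸⁺ ⊢t)                  (lam v≢x v∈t)              = tail v≢x (Free⇒∈ ⊢t v∈t)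
Free⇒∈ (⊸⁻ split ⊢t _)          (appˡ v∈t)                 = ∈-⊎⁺ˡ split (Free⇒∈ ⊢t v∈t)
Free⇒∈ (⊸⁻ split _ ⊢s)          (appʳ v∈s)                 = ∈-⊎⁺ʳ split (Free⇒∈ ⊢s v∈s)
Free⇒∈ (&⁺ ⊢t _)                (pairˡ v∈t)                = Free⇒∈ ⊢t v∈t
Free⇒∈ (&⁺ _ ⊢s)                (pairʳ v∈s)                = Free⇒∈ ⊢s v∈s
Free⇒∈ (&⁻₁ ⊢t)                 (appˡ v∈t)                 = Free⇒∈ ⊢t v∈t
Free⇒∈ (&⁻₂ ⊢t)                 (appˡ v∈t)                 = Free⇒∈ ⊢t v∈t
Free⇒∈ (𝐁⁻ split ⊢t _ _)        (appˡ v∈t)                 = ∈-⊎⁺ˡ split (Free⇒∈ ⊢t v∈t)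
Free⇒∈ (𝐁⁻ split _ ⊢s _)        (appʳ (pairˡ v∈s))         = ∈-⊎⁺ʳ split (Free⇒∈ ⊢s v∈s)
Free⇒∈ (𝐁⁻ split _ _ ⊢r)        (appʳ (pairʳ v∈r))         = ∈-⊎⁺ʳ split (Free⇒∈ ⊢r v∈r)
Free⇒∈ (⊗⁻ split _ _ _ ⊢t _)    (appˡ v∈t)                 = ∈-⊎⁺ˡ split (Free⇒∈ ⊢t v∈t)
Free⇒∈ (⊗⁻ split _ _ _ _ ⊢s)    (appʳ (lam v≢x (lam v≢y v∈s))) =
  ∈-⊎⁺ʳ split (tail v≢y (tail v≢x (Free⇒∈ ⊢s v∈s)))
Free⇒∈ (𝐋⁻ ⊢t _)                (appˡ v∈t)                 = Free⇒∈ ⊢t v∈t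
Free⇒∈ (𝐋⁻ _ ⊢s)                (appʳ (brace v∈s))         with () ← Free⇒∈ ⊢s v∈s

⊢-closed : ∀ {t τ} → [] ⊢ t ∶ τ → Closed t
⊢-closed ⊢t v v∈t with () ← Free⇒∈ ⊢t v∈t

lemma2p7 : ∀ (Γ : Ctx) (t₁ t₂ : Term) (τ : Ty) → Γ ⊢ app t₁ t₂ ∶ τ →
    (Σ Term λ t₂′ → Closed t₂′ × t₂ ≡ brace t₂′)
    ⊎ (Σ Ty λ τ′ → Σ Ty λ τ″ → Σ Ctx λ Γ₁ → Σ Ctx λ Γ₂ →
        Disjoint Γ₁ Γ₂ × (Γ₁ ⊢ t₁ ∶ τ′) × (Γ₂ ⊢ t₂ ∶ τ″))
lemma2p7 Γ t₁ t₂ τ (⊸⁻ {Γ₁ = Γ₁} {Γ₂} (disjoint , _) ⊢t₁ ⊢t₂) =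
  inj₂ (_ , _ , Γ₁ , Γ₂ , disjoint , ⊢t₁ , ⊢t₂)
lemma2p7 Γ t₁ t₂ τ (&⁻₁ ⊢t₁) = inj₂ (_ , _ , Γ , [] , (λ _ ()) , ⊢t₁ , ax-con)
lemma2p7 Γ t₁ t₂ τ (&⁻₂ ⊢t₁) = inj₂ (_ , _ , Γ , [] , (λ _ ()) , ⊢t₁ , ax-con)
lemma2p7 Γ t₁ t₂ τ (𝐁⁻ {Γ₁ = Γ₁} {Γ₂} (disjoint , _) ⊢t₁ ⊢s ⊢r) =
  inj₂ (_ , _ , Γ₁ , Γ₂ , disjoint , ⊢t₁ , &⁺ ⊢s ⊢r)
lemma2p7 Γ t₁ t₂ τ (⊗⁻ {Γ₁ = Γ₁} {Γ₂} (disjoint , _) _ _ _ ⊢t₁ ⊢s) =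
  inj₂ (_ , _ , Γ₁ , Γ₂ , disjoint , ⊢t₁ , ⊸⁺ (⊸⁺ (⊢-exchange ⊢s)))
lemma2p7 Γ t₁ t₂ τ (𝐋⁻ {s = s} _ ⊢s) = inj₁ (s , ⊢-closed ⊢s , refl)
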